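{- Let $d\geq 3$ and let $\Gamma$ be the Odd graph $O_{d+1}$. For any vertex $\gamma$ of $\Gamma$, the subgraph induced on $\Gamma_d(\gamma)$ (the set of vertices at distance $d$ from $\gamma$) has exactly $\binom{2m}{m}/2$ connected components, where $m=d/2$ if $d$ is even and $m=(d+1)/2$ if $d$ is odd. In particular, this subgraph is not connected.
   Context: The Odd graph $O_{d+1}$ has as vertices the $d$-element subsets of a fixed set $\Omega$ with $|\Omega|=2d+1$, two vertices $\alpha,\beta$ being adjacent iff $\alpha\cap\beta=\emptyset$. It is a distance-regular graph of diameter $d$. For a vertex $\gamma$, $\Gamma_d(\gamma)$ denotes the set of vertices at graph distance exactly $d$ from $\gamma$. -}

module Defs where

open import Data.Nat using (ℕ; zero; suc; _+_; _*_; _<_; _/_; _%_)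
open import Data.Nat.Combinatorics using (_C_)
open import Data.Fin using (Fin)
open import Data.Fin.Subset using (Subset; _∈_; _∉_; ∣_∣)
open import Data.Product using (Σ; _×_; ∃; ∃-syntax; _,_)
open import Relation.Binary.PropositionalEquality using (_≡_)
open import Relation.Nullary using (¬_)
open import Data.Unit using (⊤)

-- Ω = Fin (2d+1); vertices of O_{d+1}: d-element subsets of Ω
record Vertex (d : ℕ) : Set where
  constructor vtx
  field
    set  : Subset (2 * d + 1)
    card : ∣ set ∣ ≡ d
open Vertex public

Adj : ∀ {d} → Vertex d → Vertex d → Set
Adj α β = ∀ i → i ∈ set α → i ∉ set β

data WalkIn {d : ℕ} (P : Vertex d → Set) : Vertex d → Vertex d → ℕ → Set where
  nil  : ∀ {u} → P u → WalkIn P u u zero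
  cons : ∀ {u w v k} → P u → Adj u w → WalkIn P w v k → WalkIn P u v (suc k)

Anywhere : ∀ {d} → Vertex d → Set
Anywhere _ = ⊤

Dist : ∀ {d} → Vertex d → Vertex d → ℕ → Set
Dist u v k = WalkIn Anywhere u v k × (∀ j → j < k → ¬ WalkIn Anywhere u v j)

Sphere : ∀ {d} → ℕ → Vertex d → Vertex d → Set
Sphere k γ v = Dist γ v k

ConnIn : ∀ {d} → (Vertex d → Set) → Vertex d → Vertex d → Set
ConnIn S u v = ∃[ k ] WalkIn S u v k

HasComponents : ∀ {d} → (Vertex d → Set) → ℕ → Set
HasComponents {d} S c =
  Σ (Fin c → Vertex d) λ r →
    (∀ i → S (r i)) ×
    (∀ i j → ConnIn S (r i) (r j) → i ≡ j) ×
    (∀ v → S v → ∃[ i ] ConnIn S (r i) v)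

ConnectedIn : ∀ {d} → (Vertex d → Set) → Set
ConnectedIn {d} S = ∀ (u v : Vertex d) → S u → S v → ConnIn S u v

mOf : ℕ → ℕ
mOf d with d % 2
... | zero  = d / 2
... | suc _ = (d + 1) / 2

-- For a vertex v write c(v) = |v ∩ γ|.  Two disjoint d-sets
-- u, w in a (2d+1)-set satisfy d - 1 ≤ c(u) + c(w) ≤ d, so along a walk
-- from γ the value c alternates between "large" and "small", and a walk
-- of length 2i (resp. 2i+1) ends at a vertex with c ≥ d - i (resp. c ≤ i).
-- Conversely, passing through the neighbour Ω ∖ (u ∪ {y}) trades any
-- x ∈ u for any y ∉ u in two steps, which gives walks of length
-- 2(d - c(v)) and 2c(v) + 1.  Hence Γ_d(γ) is the layer
-- {v : |v ∩ K| = m} where K = γ for d = 2m and K = Ω ∖ γ for d = 2m - 1;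
-- in both cases |K| = 2m.  Inside the layer, adjacent vertices meet K in
-- complementary m-sets, while the exchanges can be made outside K, so two
-- vertices of the layer are connected iff their traces on K are equal or
-- complementary.  The components thus correspond to the C(2m, m)/2 pairs
-- of complementary m-subsets of K, represented by the m-subsets of K
-- avoiding a fixed point k₀ of K.

module Submission where

import Algebra.Lattice.Properties.BooleanAlgebra as BooleanAlgebraProperties
open import Data.Empty using (⊥-elim)
open import Data.Fin using (Fin; zero; suc; splitAt; join; _↑ˡ_; _↑ʳ_; fromℕ<)
open import Data.Fin.Properties using (splitAt-↑ˡ; splitAt-↑ʳ; join-splitAt)
open import Data.Fin.Subset
open import Data.Fin.Subset.Properties
open import Data.Nat using (ℕ; zero; suc; _+_; _*_; _∸_; _/_; _%_; _≤_; _<_; z≤n; s≤s; s≤s⁻¹; z<s)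
open import Data.Nat.Combinatorics using (_C_; nCk+nC[k+1]≡[n+1]C[k+1]; nCk≡nC[n∸k])
open import Data.Nat.DivMod using (m*n/n≡m; m*n%n≡0; [m+kn]%n≡m%n)
open import Data.Nat.Properties
open import Algebra.Properties.CommutativeSemigroup +-commutativeSemigroup using (interchange)
open import Data.Nat.Tactic.RingSolver using (solve-∀)
open import Data.Product using (_×_; _,_; proj₁; proj₂; ∃-syntax)
open import Data.Sum using (_⊎_; inj₁; inj₂)
open import Data.Unit using (tt)
open import Data.Vec using ([]; _∷_; here; there; tail)
open import Function using (_∘_)
open import Relation.Binary.PropositionalEquality
open import Relation.Nullary using (¬_; contradiction; yes; no)

open import Defs

private
  module BA {n} = BooleanAlgebraProperties (∪-∩-booleanAlgebra n)

  variable
    n : ℕ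
    x : Fin n
    p q r : Subset n

-- Cardinalities of subsets

Disjoint : Subset n → Subset n → Set
Disjoint p q = ∀ i → i ∈ p → i ∉ q

drop-∷-Disjoint : ∀ {s t} → Disjoint (s ∷ p) (t ∷ q) → Disjoint p q
drop-∷-Disjoint p#q i i∈p i∈q = p#q (suc i) (there i∈p) (there i∈q)

∣p∩q∣+∣p∩∁q∣≡∣p∣ : ∀ (p q : Subset n) → ∣ p ∩ q ∣ + ∣ p ∩ ∁ q ∣ ≡ ∣ p ∣
∣p∩q∣+∣p∩∁q∣≡∣p∣ []            []            = refl
∣p∩q∣+∣p∩∁q∣≡∣p∣ (outside ∷ p) (_       ∷ q) = ∣p∩q∣+∣p∩∁q∣≡∣p∣ p q
∣p∩q∣+∣p∩∁q∣≡∣p∣ (inside  ∷ p) (inside  ∷ q) = cong suc (∣p∩q∣+∣p∩∁q∣≡∣p∣ p q)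
∣p∩q∣+∣p∩∁q∣≡∣p∣ (inside  ∷ p) (outside ∷ q) =
  trans (+-suc _ _) (cong suc (∣p∩q∣+∣p∩∁q∣≡∣p∣ p q))

∣p∩q∣+∣∁p∩q∣≡∣q∣ : ∀ (p q : Subset n) → ∣ p ∩ q ∣ + ∣ ∁ p ∩ q ∣ ≡ ∣ q ∣
∣p∩q∣+∣∁p∩q∣≡∣q∣ p q =
  trans (cong₂ (λ s t → ∣ s ∣ + ∣ t ∣) (∩-comm p q) (∩-comm (∁ p) q)) (∣p∩q∣+∣p∩∁q∣≡∣p∣ q p)

∣p∣+∣∁p∣≡n : ∀ (p : Subset n) → ∣ p ∣ + ∣ ∁ p ∣ ≡ n
∣p∣+∣∁p∣≡n p = trans (cong (∣ p ∣ +_) (∣∁p∣≡n∸∣p∣ p)) (m+[n∸m]≡n (∣p∣≤n p))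

∣p∪q∣≡∣p∣+∣q∣ : ∀ (p q : Subset n) → Disjoint p q → ∣ p ∪ q ∣ ≡ ∣ p ∣ + ∣ q ∣
∣p∪q∣≡∣p∣+∣q∣ []            []            _   = refl
∣p∪q∣≡∣p∣+∣q∣ (outside ∷ p) (outside ∷ q) p#q = ∣p∪q∣≡∣p∣+∣q∣ p q (drop-∷-Disjoint p#q)
∣p∪q∣≡∣p∣+∣q∣ (outside ∷ p) (inside  ∷ q) p#q =
  trans (cong suc (∣p∪q∣≡∣p∣+∣q∣ p q (drop-∷-Disjoint p#q))) (sym (+-suc _ _))
∣p∪q∣≡∣p∣+∣q∣ (inside  ∷ p) (outside ∷ q) p#q = cong suc (∣p∪q∣≡∣p∣+∣q∣ p q (drop-∷-Disjoint p#q))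
∣p∪q∣≡∣p∣+∣q∣ (inside  ∷ p) (inside  ∷ q) p#q = ⊥-elim (p#q zero here here)

Disjoint⇒⊆∁ : Disjoint p q → q ⊆ ∁ p
Disjoint⇒⊆∁ p#q {i} i∈q = x∉p⇒x∈∁p (λ i∈p → p#q i i∈p i∈q)

p⊆r∧q⊆∁r⇒Disjoint : p ⊆ r → q ⊆ ∁ r → Disjoint p q
p⊆r∧q⊆∁r⇒Disjoint p⊆r q⊆∁r i i∈p i∈q = x∈p⇒x∉∁p (p⊆r i∈p) (q⊆∁r i∈q)

∩-monoˡ-⊆ : p ⊆ q → p ∩ r ⊆ q ∩ r
∩-monoˡ-⊆ {p = p} {r = r} p⊆q i∈p∩r =
  let (i∈p , i∈r) = x∈p∩q⁻ p r i∈p∩r in x∈p∩q⁺ (p⊆q i∈p , i∈r)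

Disjoint⇒∣p∩r∣+∣q∩r∣≤∣r∣ : ∀ (p q r : Subset n) → Disjoint p q → ∣ p ∩ r ∣ + ∣ q ∩ r ∣ ≤ ∣ r ∣
Disjoint⇒∣p∩r∣+∣q∩r∣≤∣r∣ p q r p#q = begin
  ∣ p ∩ r ∣ + ∣ q ∩ r ∣    ≤⟨ +-monoʳ-≤ ∣ p ∩ r ∣ (p⊆q⇒∣p∣≤∣q∣ (∩-monoˡ-⊆ (Disjoint⇒⊆∁ p#q))) ⟩
  ∣ p ∩ r ∣ + ∣ ∁ p ∩ r ∣  ≡⟨ ∣p∩q∣+∣∁p∩q∣≡∣q∣ p r ⟩
  ∣ r ∣                    ∎
  where open ≤-Reasoning

p⊆q∧∣q∣≤∣p∣⇒p≡q : p ⊆ q → ∣ q ∣ ≤ ∣ p ∣ → p ≡ q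
p⊆q∧∣q∣≤∣p∣⇒p≡q {p = []}          {[]}          _   _ = refl
p⊆q∧∣q∣≤∣p∣⇒p≡q {p = outside ∷ p} {outside ∷ q} p⊆q l =
  cong (outside ∷_) (p⊆q∧∣q∣≤∣p∣⇒p≡q (drop-∷-⊆ p⊆q) l)
p⊆q∧∣q∣≤∣p∣⇒p≡q {p = outside ∷ p} {inside  ∷ q} p⊆q l =
  ⊥-elim (1+n≰n (≤-trans l (p⊆q⇒∣p∣≤∣q∣ (drop-∷-⊆ p⊆q))))
p⊆q∧∣q∣≤∣p∣⇒p≡q {p = inside  ∷ p} {outside ∷ q} p⊆q _ = contradiction (p⊆q here) λ ()
p⊆q∧∣q∣≤∣p∣⇒p≡q {p = inside  ∷ p} {inside  ∷ q} p⊆q l =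
  cong (inside ∷_) (p⊆q∧∣q∣≤∣p∣⇒p≡q (drop-∷-⊆ p⊆q) (s≤s⁻¹ l))

∣p∣≡1+k⇒Nonempty : ∀ (p : Subset n) {k} → ∣ p ∣ ≡ suc k → Nonempty p
∣p∣≡1+k⇒Nonempty (inside  ∷ p) _ = zero , here
∣p∣≡1+k⇒Nonempty (outside ∷ p) e = let (i , i∈p) = ∣p∣≡1+k⇒Nonempty p e in suc i , there i∈p

p⊆q⇒p∩q≡p : p ⊆ q → p ∩ q ≡ p
p⊆q⇒p∩q≡p {p = p} {q} p⊆q = ⊆-antisym (p∩q⊆p p q) (λ i∈p → x∈p∩q⁺ (i∈p , p⊆q i∈p))

Disjoint⇒p∩q≡⊥ : Disjoint p q → p ∩ q ≡ ⊥
Disjoint⇒p∩q≡⊥ {p = p} {q} p#q =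
  ⊆-antisym (λ {i} i∈p∩q → let (i∈p , i∈q) = x∈p∩q⁻ p q i∈p∩q in ⊥-elim (p#q i i∈p i∈q)) (⊆-min _)

x∈p⇒⁅x⁆⊆p : x ∈ p → ⁅ x ⁆ ⊆ p
x∈p⇒⁅x⁆⊆p {x = x} x∈p i∈⁅x⁆ = subst (_∈ _) (sym (x∈⁅y⁆⇒x≡y x i∈⁅x⁆)) x∈p

x∈p⇒1+∣p∩∁⁅x⁆∣≡∣p∣ : x ∈ p → suc ∣ p ∩ ∁ ⁅ x ⁆ ∣ ≡ ∣ p ∣
x∈p⇒1+∣p∩∁⁅x⁆∣≡∣p∣ {x = x} {p = p} x∈p = begin
  suc ∣ p ∩ ∁ ⁅ x ⁆ ∣              ≡⟨ cong (_+ ∣ p ∩ ∁ ⁅ x ⁆ ∣) (∣⁅x⁆∣≡1 x) ⟨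
  ∣ ⁅ x ⁆ ∣ + ∣ p ∩ ∁ ⁅ x ⁆ ∣      ≡⟨ cong (λ s → ∣ s ∣ + ∣ p ∩ ∁ ⁅ x ⁆ ∣) p∩⁅x⁆≡⁅x⁆ ⟨
  ∣ p ∩ ⁅ x ⁆ ∣ + ∣ p ∩ ∁ ⁅ x ⁆ ∣  ≡⟨ ∣p∩q∣+∣p∩∁q∣≡∣p∣ p ⁅ x ⁆ ⟩
  ∣ p ∣                            ∎
  where
  open ≡-Reasoning
  p∩⁅x⁆≡⁅x⁆ : p ∩ ⁅ x ⁆ ≡ ⁅ x ⁆
  p∩⁅x⁆≡⁅x⁆ = trans (∩-comm p ⁅ x ⁆) (p⊆q⇒p∩q≡p (x∈p⇒⁅x⁆⊆p x∈p))

∣p∩∁q∣≡0⇒p⊆q : ∀ (p q : Subset n) → ∣ p ∩ ∁ q ∣ ≡ 0 → p ⊆ q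
∣p∩∁q∣≡0⇒p⊆q p q e {i} i∈p with i ∈? q
... | yes i∈q = i∈q
... | no  i∉q = contradiction (trans (x∈p⇒1+∣p∩∁⁅x⁆∣≡∣p∣ (x∈p∩q⁺ (i∈p , x∉p⇒x∈∁p i∉q))) e) λ ()

∣p∣≡∣q∣⇒∣p∩∁q∣≡∣q∩∁p∣ : ∀ (p q : Subset n) → ∣ p ∣ ≡ ∣ q ∣ → ∣ p ∩ ∁ q ∣ ≡ ∣ q ∩ ∁ p ∣
∣p∣≡∣q∣⇒∣p∩∁q∣≡∣q∩∁p∣ p q e = +-cancelˡ-≡ ∣ p ∩ q ∣ _ _ (begin
  ∣ p ∩ q ∣ + ∣ p ∩ ∁ q ∣  ≡⟨ ∣p∩q∣+∣p∩∁q∣≡∣p∣ p q ⟩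
  ∣ p ∣                    ≡⟨ e ⟩
  ∣ q ∣                    ≡⟨ ∣p∩q∣+∣p∩∁q∣≡∣p∣ q p ⟨
  ∣ q ∩ p ∣ + ∣ q ∩ ∁ p ∣  ≡⟨ cong (λ s → ∣ s ∣ + ∣ q ∩ ∁ p ∣) (∩-comm q p) ⟩
  ∣ p ∩ q ∣ + ∣ q ∩ ∁ p ∣  ∎)
  where open ≡-Reasoning

∁[p∪⁅x⁆]∩q≡∁p∩q∩∁⁅x⁆ : ∀ (p q : Subset n) x → ∁ (p ∪ ⁅ x ⁆) ∩ q ≡ (∁ p ∩ q) ∩ ∁ ⁅ x ⁆
∁[p∪⁅x⁆]∩q≡∁p∩q∩∁⁅x⁆ p q x = begin
  ∁ (p ∪ ⁅ x ⁆) ∩ q      ≡⟨ cong (_∩ q) (BA.deMorgan₂ p ⁅ x ⁆) ⟩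
  (∁ p ∩ ∁ ⁅ x ⁆) ∩ q    ≡⟨ ∩-assoc (∁ p) (∁ ⁅ x ⁆) q ⟩
  ∁ p ∩ (∁ ⁅ x ⁆ ∩ q)    ≡⟨ cong (∁ p ∩_) (∩-comm (∁ ⁅ x ⁆) q) ⟩
  ∁ p ∩ (q ∩ ∁ ⁅ x ⁆)    ≡⟨ ∩-assoc (∁ p) q (∁ ⁅ x ⁆) ⟨
  (∁ p ∩ q) ∩ ∁ ⁅ x ⁆    ∎
  where open ≡-Reasoning

x∈∁p∩q⇒1+∣∁[p∪⁅x⁆]∩q∣≡∣∁p∩q∣ : x ∈ ∁ p ∩ q → suc ∣ ∁ (p ∪ ⁅ x ⁆) ∩ q ∣ ≡ ∣ ∁ p ∩ q ∣
x∈∁p∩q⇒1+∣∁[p∪⁅x⁆]∩q∣≡∣∁p∩q∣ {x = x} {p = p} {q = q} x∈∁p∩q =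
  trans (cong (λ s → suc ∣ s ∣) (∁[p∪⁅x⁆]∩q≡∁p∩q∩∁⁅x⁆ p q x)) (x∈p⇒1+∣p∩∁⁅x⁆∣≡∣p∣ x∈∁p∩q)

x∉q⇒∁[p∪⁅x⁆]∩q≡∁p∩q : x ∉ q → ∁ (p ∪ ⁅ x ⁆) ∩ q ≡ ∁ p ∩ q
x∉q⇒∁[p∪⁅x⁆]∩q≡∁p∩q {x = x} {q = q} {p = p} x∉q =
  trans (∁[p∪⁅x⁆]∩q≡∁p∩q∩∁⁅x⁆ p q x) (p⊆q⇒p∩q≡p ∁p∩q⊆∁⁅x⁆)
  where
  ∁p∩q⊆∁⁅x⁆ : ∁ p ∩ q ⊆ ∁ ⁅ x ⁆
  ∁p∩q⊆∁⁅x⁆ {i} i∈∁p∩q = x∉p⇒x∈∁p λ i∈⁅x⁆ →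
    x∉q (subst (_∈ q) (x∈⁅y⁆⇒x≡y x i∈⁅x⁆) (proj₂ (x∈p∩q⁻ (∁ p) q i∈∁p∩q)))

x∈q⇒[p∪⁅x⁆]∩∁q≡p∩∁q : x ∈ q → (p ∪ ⁅ x ⁆) ∩ ∁ q ≡ p ∩ ∁ q
x∈q⇒[p∪⁅x⁆]∩∁q≡p∩∁q {x = x} {q = q} {p = p} x∈q = begin
  (p ∪ ⁅ x ⁆) ∩ ∁ q            ≡⟨ ∩-distribʳ-∪ (∁ q) p ⁅ x ⁆ ⟩
  (p ∩ ∁ q) ∪ (⁅ x ⁆ ∩ ∁ q)    ≡⟨ cong (p ∩ ∁ q ∪_) (Disjoint⇒p∩q≡⊥ ⁅x⁆#∁q) ⟩
  (p ∩ ∁ q) ∪ ⊥                ≡⟨ ∪-identityʳ (p ∩ ∁ q) ⟩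
  p ∩ ∁ q                      ∎
  where
  open ≡-Reasoning
  ⁅x⁆#∁q : Disjoint ⁅ x ⁆ (∁ q)
  ⁅x⁆#∁q i i∈⁅x⁆ = x∈p⇒x∉∁p (x∈p⇒⁅x⁆⊆p x∈q i∈⁅x⁆)

∁p∩r≡∁[p∩r]∩r : ∀ (p r : Subset n) → ∁ p ∩ r ≡ ∁ (p ∩ r) ∩ r
∁p∩r≡∁[p∩r]∩r p r = sym (begin
  ∁ (p ∩ r) ∩ r                ≡⟨ cong (_∩ r) (BA.deMorgan₁ p r) ⟩
  (∁ p ∪ ∁ r) ∩ r              ≡⟨ ∩-distribʳ-∪ r (∁ p) (∁ r) ⟩
  (∁ p ∩ r) ∪ (∁ r ∩ r)        ≡⟨ cong (∁ p ∩ r ∪_) (∩-inverseˡ r) ⟩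
  (∁ p ∩ r) ∪ ⊥                ≡⟨ ∪-identityʳ (∁ p ∩ r) ⟩
  ∁ p ∩ r                      ∎)
  where open ≡-Reasoning

p∩r≡q∩r⇒∁p∩r≡∁q∩r : ∀ (p q r : Subset n) → p ∩ r ≡ q ∩ r → ∁ p ∩ r ≡ ∁ q ∩ r
p∩r≡q∩r⇒∁p∩r≡∁q∩r p q r e =
  trans (∁p∩r≡∁[p∩r]∩r p r) (trans (cong (λ s → ∁ s ∩ r) e) (sym (∁p∩r≡∁[p∩r]∩r q r)))

p∩r≡∁q∩r⇒∁p∩r≡q∩r : ∀ (p q r : Subset n) → p ∩ r ≡ ∁ q ∩ r → ∁ p ∩ r ≡ q ∩ r
p∩r≡∁q∩r⇒∁p∩r≡q∩r p q r e = trans (p∩r≡q∩r⇒∁p∩r≡∁q∩r p (∁ q) r e) (cong (_∩ r) (BA.¬-involutive q))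

p∩r≡q∩r∧x∈p∧x∉q⇒x∉r : p ∩ r ≡ q ∩ r → x ∈ p → x ∉ q → x ∉ r
p∩r≡q∩r∧x∈p∧x∉q⇒x∉r {p = p} {r = r} {q = q} e x∈p x∉q x∈r =
  x∉q (proj₁ (x∈p∩q⁻ q r (subst (_ ∈_) e (x∈p∩q⁺ (x∈p , x∈r)))))

x∉p⇒p∩q⊆q∩∁⁅x⁆ : ∀ (p q : Subset n) → x ∉ p → p ∩ q ⊆ q ∩ ∁ ⁅ x ⁆
x∉p⇒p∩q⊆q∩∁⁅x⁆ {x = x} p q x∉p i∈p∩q = let (i∈p , i∈q) = x∈p∩q⁻ p q i∈p∩q in
  x∈p∩q⁺ (i∈q , x∉p⇒x∈∁p λ i∈⁅x⁆ → x∉p (subst (_∈ p) (x∈⁅y⁆⇒x≡y x i∈⁅x⁆) i∈p))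

-- Enumerating the k-subsets of a subset

binomial : ℕ → ℕ → ℕ
binomial n       zero    = 1
binomial zero    (suc k) = 0
binomial (suc n) (suc k) = binomial n k + binomial n (suc k)

binomial-positive : ∀ n k → k ≤ n → 0 < binomial n k
binomial-positive n       zero    _         = z<s
binomial-positive (suc n) (suc k) (s≤s k≤n) = ≤-trans (binomial-positive n k k≤n) (m≤m+n _ _)

binomial≡C : ∀ n k → binomial n k ≡ n C k
binomial≡C n       zero    = refl
binomial≡C zero    (suc k) = refl
binomial≡C (suc n) (suc k) =
  trans (cong₂ _+_ (binomial≡C n k) (binomial≡C n (suc k))) (nCk+nC[k+1]≡[n+1]C[k+1] n k)

m+m≡m*2 : ∀ m → m + m ≡ m * 2
m+m≡m*2 = solve-∀

half-central-binomial : ∀ p → ((2 * suc p) C suc p) / 2 ≡ binomial (suc (p + p)) (suc p)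
half-central-binomial p = begin
  ((2 * suc p) C suc p) / 2                      ≡⟨ cong (λ x → (x C suc p) / 2) (2[1+p]≡2+p+p p) ⟩
  (suc N C suc p) / 2                            ≡⟨ cong (_/ 2) (binomial≡C (suc N) (suc p)) ⟨
  (binomial N p + binomial N (suc p)) / 2        ≡⟨ cong (λ b → (b + binomial N (suc p)) / 2) symmetry ⟩
  (binomial N (suc p) + binomial N (suc p)) / 2  ≡⟨ cong (_/ 2) (m+m≡m*2 (binomial N (suc p))) ⟩
  (binomial N (suc p) * 2) / 2                   ≡⟨ m*n/n≡m (binomial N (suc p)) 2 ⟩
  binomial N (suc p)                             ∎
  where
  open ≡-Reasoning
  N = suc (p + p)
  2[1+p]≡2+p+p : ∀ p → 2 * suc p ≡ suc (suc (p + p))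
  2[1+p]≡2+p+p = solve-∀
  symmetry : binomial N p ≡ binomial N (suc p)
  symmetry = begin
    binomial N p        ≡⟨ binomial≡C N p ⟩
    N C p               ≡⟨ nCk≡nC[n∸k] (≤-trans (m≤m+n p p) (n≤1+n _)) ⟩
    N C (N ∸ p)         ≡⟨ cong (N C_) (trans (cong (_∸ p) (sym (+-suc p p))) (m+n∸m≡n p (suc p))) ⟩
    N C suc p           ≡⟨ binomial≡C N (suc p) ⟨
    binomial N (suc p)  ∎

2≤binomial[1+2p][1+p] : ∀ p → 1 ≤ p → 2 ≤ binomial (suc (p + p)) (suc p)
2≤binomial[1+2p][1+p] p 1≤p =
  +-mono-≤ (binomial-positive (p + p) p (m≤m+n p p))
           (binomial-positive (p + p) (suc p) (+-monoˡ-≤ p 1≤p))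

choose : (A : Subset n) (k : ℕ) → Fin (binomial ∣ A ∣ k) → Subset n
choose []            zero    zero = []
choose (outside ∷ A) k       i    = outside ∷ choose A k i
choose (inside  ∷ A) zero    zero = ⊥
choose (inside  ∷ A) (suc k) i with splitAt (binomial ∣ A ∣ k) i
... | inj₁ j = inside  ∷ choose A k j
... | inj₂ j = outside ∷ choose A (suc k) j

choose-⊆ : ∀ (A : Subset n) k i → choose A k i ⊆ A
choose-⊆ []            zero    zero = λ ()
choose-⊆ (outside ∷ A) k       i    = out⊆ (choose-⊆ A k i)
choose-⊆ (inside  ∷ A) zero    zero = ⊆-min _
choose-⊆ (inside  ∷ A) (suc k) i with splitAt (binomial ∣ A ∣ k) i
... | inj₁ j = s⊆s (choose-⊆ A k j)
... | inj₂ j = out⊆ (choose-⊆ A (suc k) j)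

∣choose∣≡k : ∀ (A : Subset n) k i → ∣ choose A k i ∣ ≡ k
∣choose∣≡k         []            zero    zero = refl
∣choose∣≡k         (outside ∷ A) k       i    = ∣choose∣≡k A k i
∣choose∣≡k {suc n} (inside  ∷ A) zero    zero = ∣⊥∣≡0 (suc n)
∣choose∣≡k         (inside  ∷ A) (suc k) i with splitAt (binomial ∣ A ∣ k) i
... | inj₁ j = cong suc (∣choose∣≡k A k j)
... | inj₂ j = ∣choose∣≡k A (suc k) j

splitAt⇒≡join : ∀ {m l} {i : Fin (m + l)} {s} → splitAt m i ≡ s → i ≡ join m l s
splitAt⇒≡join {m} {l} {i} e = trans (sym (join-splitAt m l i)) (cong (join m l) e)

choose-injective : ∀ (A : Subset n) k i j → choose A k i ≡ choose A k j → i ≡ j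
choose-injective []            zero    zero zero _ = refl
choose-injective (outside ∷ A) k       i    j    e = choose-injective A k i j (cong tail e)
choose-injective (inside  ∷ A) zero    zero zero _ = refl
choose-injective (inside  ∷ A) (suc k) i    j    e
  with splitAt (binomial ∣ A ∣ k) i in i≡ | splitAt (binomial ∣ A ∣ k) j in j≡
... | inj₁ i′ | inj₁ j′ = trans (splitAt⇒≡join i≡) (trans
  (cong (join _ _ ∘ inj₁) (choose-injective A k i′ j′ (cong tail e))) (sym (splitAt⇒≡join j≡)))
... | inj₂ i′ | inj₂ j′ = trans (splitAt⇒≡join i≡) (trans
  (cong (join _ _ ∘ inj₂) (choose-injective A (suc k) i′ j′ (cong tail e))) (sym (splitAt⇒≡join j≡)))
... | inj₁ _  | inj₂ _  = contradiction e λ ()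
... | inj₂ _  | inj₁ _  = contradiction e λ ()

choose-↑ˡ : ∀ (A : Subset n) k j →
            choose (inside ∷ A) (suc k) (j ↑ˡ binomial ∣ A ∣ (suc k)) ≡ inside ∷ choose A k j
choose-↑ˡ A k j rewrite splitAt-↑ˡ (binomial ∣ A ∣ k) j (binomial ∣ A ∣ (suc k)) = refl

choose-↑ʳ : ∀ (A : Subset n) k j →
            choose (inside ∷ A) (suc k) (binomial ∣ A ∣ k ↑ʳ j) ≡ outside ∷ choose A (suc k) j
choose-↑ʳ A k j rewrite splitAt-↑ʳ (binomial ∣ A ∣ k) (binomial ∣ A ∣ (suc k)) j = refl

choose-surjective : ∀ (A : Subset n) k B → B ⊆ A → ∣ B ∣ ≡ k → ∃[ i ] choose A k i ≡ B
choose-surjective         []            zero    []            _   _ = zero , refl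
choose-surjective         (outside ∷ A) k       (outside ∷ B) B⊆A e
  with choose-surjective A k B (drop-∷-⊆ B⊆A) e
... | i , refl = i , refl
choose-surjective         (outside ∷ A) k       (inside  ∷ B) B⊆A _ = contradiction (B⊆A here) λ ()
choose-surjective {suc n} (inside  ∷ A) zero    B             _   e =
  zero , p⊆q∧∣q∣≤∣p∣⇒p≡q (⊆-min B) (≤-reflexive (trans e (sym (∣⊥∣≡0 (suc n)))))
choose-surjective         (inside  ∷ A) (suc k) (inside  ∷ B) B⊆A e
  with choose-surjective A k B (drop-∷-⊆ B⊆A) (suc-injective e)
... | j , refl = j ↑ˡ _ , choose-↑ˡ A k j
choose-surjective         (inside  ∷ A) (suc k) (outside ∷ B) B⊆A e
  with choose-surjective A (suc k) B (drop-∷-⊆ B⊆A) e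
... | j , refl = _ ↑ʳ j , choose-↑ʳ A k j

-- Walks and components

walk-map : ∀ {d} {P Q : Vertex d → Set} → (∀ {w} → P w → Q w) →
           ∀ {u v k} → WalkIn P u v k → WalkIn Q u v k
walk-map P⇒Q (nil Pu)          = nil (P⇒Q Pu)
walk-map P⇒Q (cons Pu u~w w⇝v) = cons (P⇒Q Pu) u~w (walk-map P⇒Q w⇝v)

walk-start : ∀ {d} {P : Vertex d → Set} {u v k} → WalkIn P u v k → P u
walk-start (nil Pu)      = Pu
walk-start (cons Pu _ _) = Pu

HasComponents-cong : ∀ {d} {S T : Vertex d → Set} {c} → (∀ {v} → S v → T v) → (∀ {v} → T v → S v) →
                     HasComponents S c → HasComponents T c
HasComponents-cong S⇒T T⇒S (r , r∈S , distinct , cover) =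
  r , (λ i → S⇒T (r∈S i)) , (λ i j (k , w) → distinct i j (k , walk-map T⇒S w)) ,
  λ v v∈T → let (i , k , w) = cover v (T⇒S v∈T) in i , k , walk-map S⇒T w

HasComponents⇒¬ConnectedIn : ∀ {d} {S : Vertex d → Set} {c} → HasComponents S c → 2 ≤ c → ¬ ConnectedIn S
HasComponents⇒¬ConnectedIn {c = suc zero}    _                       (s≤s ())
HasComponents⇒¬ConnectedIn {c = suc (suc c)} (r , r∈S , distinct , _) _ connected
  with distinct zero (suc zero) (connected (r zero) (r (suc zero)) (r∈S zero) (r∈S (suc zero)))
... | ()

-- Vertices of the Odd graph

module _ {d : ℕ} where

  private
    Ω : Set
    Ω = Fin (2 * d + 1)

    2d+1≡d+[1+d] : ∀ d → 2 * d + 1 ≡ d + suc d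
    2d+1≡d+[1+d] = solve-∀

  vertex-≡ : {u v : Vertex d} → set u ≡ set v → u ≡ v
  vertex-≡ {vtx s c} {vtx s c′} refl = cong (vtx s) (≡-irrelevant c c′)

  ∣∁v∣≡1+d : (v : Vertex d) → ∣ ∁ (set v) ∣ ≡ suc d
  ∣∁v∣≡1+d v = begin
    ∣ ∁ (set v) ∣              ≡⟨ ∣∁p∣≡n∸∣p∣ (set v) ⟩
    (2 * d + 1) ∸ ∣ set v ∣    ≡⟨ cong₂ _∸_ (2d+1≡d+[1+d] d) (card v) ⟩
    (d + suc d) ∸ d            ≡⟨ m+n∸m≡n d (suc d) ⟩
    suc d                      ∎
    where open ≡-Reasoning

  ∣∁K∩∁v∣+∣K∣≡∣v∩K∣+1+d : ∀ (K : Subset (2 * d + 1)) v →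
                          ∣ ∁ K ∩ ∁ (set v) ∣ + ∣ K ∣ ≡ ∣ set v ∩ K ∣ + suc d
  ∣∁K∩∁v∣+∣K∣≡∣v∩K∣+1+d K v = begin
    c + ∣ K ∣                      ≡⟨ cong (c +_) (∣p∩q∣+∣p∩∁q∣≡∣p∣ K (set v)) ⟨
    c + (a + b)                    ≡⟨ +-comm c (a + b) ⟩
    (a + b) + c                    ≡⟨ +-assoc a b c ⟩
    a + (b + c)                    ≡⟨ cong₂ _+_ (cong ∣_∣ (∩-comm K (set v))) (∣p∩q∣+∣∁p∩q∣≡∣q∣ K _) ⟩
    ∣ set v ∩ K ∣ + ∣ ∁ (set v) ∣  ≡⟨ cong (∣ set v ∩ K ∣ +_) (∣∁v∣≡1+d v) ⟩
    ∣ set v ∩ K ∣ + suc d          ∎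
    where
    open ≡-Reasoning
    a = ∣ K ∩ set v ∣
    b = ∣ K ∩ ∁ (set v) ∣
    c = ∣ ∁ K ∩ ∁ (set v) ∣

  opposite : (u : Vertex d) (x : Ω) → x ∉ set u → Vertex d
  opposite u x x∉u = vtx (∁ (set u ∪ ⁅ x ⁆)) (begin
    ∣ ∁ (set u ∪ ⁅ x ⁆) ∣                ≡⟨ ∣∁p∣≡n∸∣p∣ (set u ∪ ⁅ x ⁆) ⟩
    (2 * d + 1) ∸ ∣ set u ∪ ⁅ x ⁆ ∣      ≡⟨ cong₂ _∸_ 2d+1≡1+d+d ∣u∪⁅x⁆∣≡1+d ⟩
    (suc d + d) ∸ suc d                  ≡⟨ m+n∸m≡n (suc d) d ⟩
    d                                    ∎)
    where
    open ≡-Reasoning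
    2d+1≡1+d+d = trans (2d+1≡d+[1+d] d) (+-comm d (suc d))
    u#⁅x⁆ : Disjoint (set u) ⁅ x ⁆
    u#⁅x⁆ i i∈u i∈⁅x⁆ = x∉u (subst (_∈ set u) (x∈⁅y⁆⇒x≡y x i∈⁅x⁆) i∈u)
    ∣u∪⁅x⁆∣≡1+d : ∣ set u ∪ ⁅ x ⁆ ∣ ≡ suc d
    ∣u∪⁅x⁆∣≡1+d = begin
      ∣ set u ∪ ⁅ x ⁆ ∣      ≡⟨ ∣p∪q∣≡∣p∣+∣q∣ (set u) ⁅ x ⁆ u#⁅x⁆ ⟩
      ∣ set u ∣ + ∣ ⁅ x ⁆ ∣  ≡⟨ cong₂ _+_ (card u) (∣⁅x⁆∣≡1 x) ⟩
      d + 1                  ≡⟨ +-comm d 1 ⟩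
      suc d                  ∎

  opposite-adjacent : ∀ u x (x∉u : x ∉ set u) → Adj u (opposite u x x∉u)
  opposite-adjacent u x _ i i∈u = x∈p⇒x∉∁p (p⊆p∪q ⁅ x ⁆ i∈u)

  Agrees : Subset (2 * d + 1) → Subset (2 * d + 1) → Vertex d → Set
  Agrees K s w = set w ∩ K ≡ s ∩ K

  AgreesOrOpposes : Subset (2 * d + 1) → Subset (2 * d + 1) → Vertex d → Set
  AgreesOrOpposes K s w = Agrees K s w ⊎ Agrees K (∁ s) w

  agrees-on-⊥ : ∀ s w → Agrees ⊥ s w
  agrees-on-⊥ s w = trans (∩-zeroʳ (set w)) (sym (∩-zeroʳ s))

  -- u, Ω ∖ (u ∪ {y}), (u ∪ {y}) ∖ {x} is a walk trading x ∈ u ∖ v for y ∈ v ∖ u;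
  -- since x, y ∉ K, the trace on K is complemented and then restored.
  module Exchange (K s : Subset (2 * d + 1)) (u v : Vertex d) (u≈s : Agrees K s u) (v≈s : Agrees K s v)
                  {x y : Ω} (x∈u∩∁v : x ∈ set u ∩ ∁ (set v)) (y∈v∩∁u : y ∈ set v ∩ ∁ (set u)) where

    private
      x∈u = proj₁ (x∈p∩q⁻ (set u) _ x∈u∩∁v)
      x∈∁v = proj₂ (x∈p∩q⁻ (set u) _ x∈u∩∁v)
      y∈v = proj₁ (x∈p∩q⁻ (set v) _ y∈v∩∁u)
      y∉u = x∈∁p⇒x∉p (proj₂ (x∈p∩q⁻ (set v) _ y∈v∩∁u))
      x∉K = p∩r≡q∩r∧x∈p∧x∉q⇒x∉r (trans u≈s (sym v≈s)) x∈u (x∈∁p⇒x∉p x∈∁v)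
      y∉K = p∩r≡q∩r∧x∈p∧x∉q⇒x∉r (trans v≈s (sym u≈s)) y∈v y∉u
      x∉middle = x∈p⇒x∉∁p (p⊆p∪q ⁅ y ⁆ x∈u)

    middle : Vertex d
    middle = opposite u y y∉u

    target : Vertex d
    target = opposite middle x x∉middle

    u~middle : Adj u middle
    u~middle = opposite-adjacent u y y∉u

    middle~target : Adj middle target
    middle~target = opposite-adjacent middle x x∉middle

    middle≈∁s : Agrees K (∁ s) middle
    middle≈∁s = trans (x∉q⇒∁[p∪⁅x⁆]∩q≡∁p∩q y∉K) (p∩r≡q∩r⇒∁p∩r≡∁q∩r (set u) s K u≈s)

    target≈s : Agrees K s target
    target≈s = trans (x∉q⇒∁[p∪⁅x⁆]∩q≡∁p∩q x∉K) (p∩r≡∁q∩r⇒∁p∩r≡q∩r (set middle) s K middle≈∁s)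

    1+∣target∩∁v∣≡∣u∩∁v∣ : suc ∣ set target ∩ ∁ (set v) ∣ ≡ ∣ set u ∩ ∁ (set v) ∣
    1+∣target∩∁v∣≡∣u∩∁v∣ = begin
      suc ∣ set target ∩ ∁ (set v) ∣   ≡⟨ x∈∁p∩q⇒1+∣∁[p∪⁅x⁆]∩q∣≡∣∁p∩q∣ x∈∁middle∩∁v ⟩
      ∣ ∁ (set middle) ∩ ∁ (set v) ∣   ≡⟨ cong (λ s → ∣ s ∩ ∁ (set v) ∣) (BA.¬-involutive (set u ∪ ⁅ y ⁆)) ⟩
      ∣ (set u ∪ ⁅ y ⁆) ∩ ∁ (set v) ∣  ≡⟨ cong ∣_∣ (x∈q⇒[p∪⁅x⁆]∩∁q≡p∩∁q {p = set u} y∈v) ⟩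
      ∣ set u ∩ ∁ (set v) ∣            ∎
      where
      open ≡-Reasoning
      x∈∁middle∩∁v : x ∈ ∁ (set middle) ∩ ∁ (set v)
      x∈∁middle∩∁v = x∈p∩q⁺ (x∉p⇒x∈∁p x∉middle , x∈∁v)

  exchange-walk : ∀ K s (u v : Vertex d) t → Agrees K s u → Agrees K s v →
                  ∣ set u ∩ ∁ (set v) ∣ ≡ t → WalkIn (AgreesOrOpposes K s) u v (t + t)
  exchange-walk K s u v zero    u≈s _   e = subst (λ w → WalkIn _ u w 0) (vertex-≡ u≡v) (nil (inj₁ u≈s))
    where
    u≡v : set u ≡ set v
    u≡v = p⊆q∧∣q∣≤∣p∣⇒p≡q (∣p∩∁q∣≡0⇒p⊆q (set u) (set v) e) (≤-reflexive (trans (card v) (sym (card u))))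
  exchange-walk K s u v (suc t) u≈s v≈s e =
    let (x , x∈u∩∁v) = ∣p∣≡1+k⇒Nonempty (set u ∩ ∁ (set v)) e
        (y , y∈v∩∁u) = ∣p∣≡1+k⇒Nonempty (set v ∩ ∁ (set u)) (trans (sym ∣u∩∁v∣≡∣v∩∁u∣) e)
        open Exchange K s u v u≈s v≈s x∈u∩∁v y∈v∩∁u
    in subst (WalkIn (AgreesOrOpposes K s) u v) (cong suc (sym (+-suc t t)))
         (cons {w = middle} (inj₁ u≈s) u~middle (cons {w = target} (inj₂ middle≈∁s) middle~target
           (exchange-walk K s target v t target≈s v≈s (suc-injective (trans 1+∣target∩∁v∣≡∣u∩∁v∣ e)))))
    where
    ∣u∩∁v∣≡∣v∩∁u∣ = ∣p∣≡∣q∣⇒∣p∩∁q∣≡∣q∩∁p∣ (set u) (set v) (trans (card u) (sym (card v)))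

-- Distance from a vertex

data EvenOdd : ℕ → Set where
  even : ∀ m → EvenOdd (m + m)
  odd  : ∀ m → EvenOdd (suc (m + m))

evenOdd : ∀ n → EvenOdd n
evenOdd zero    = even 0
evenOdd (suc n) with evenOdd n
... | even m = odd m
... | odd  m = subst EvenOdd (cong suc (+-suc m m)) (even (suc m))

module Distance {d : ℕ} (γ : Vertex d) where

  common : Vertex d → ℕ
  common v = ∣ set v ∩ set γ ∣

  common+∣v∩∁γ∣≡d : ∀ v → common v + ∣ set v ∩ ∁ (set γ) ∣ ≡ d
  common+∣v∩∁γ∣≡d v = trans (∣p∩q∣+∣p∩∁q∣≡∣p∣ (set v) (set γ)) (card v)

  common+∣γ∩∁v∣≡d : ∀ v → common v + ∣ set γ ∩ ∁ (set v) ∣ ≡ d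
  common+∣γ∩∁v∣≡d v =
    trans (cong (common v +_) (∣p∣≡∣q∣⇒∣p∩∁q∣≡∣q∩∁p∣ (set γ) (set v) (trans (card γ) (sym (card v)))))
          (common+∣v∩∁γ∣≡d v)

  ∣∁γ∩∁v∣≡1+common : ∀ v → ∣ ∁ (set γ) ∩ ∁ (set v) ∣ ≡ suc (common v)
  ∣∁γ∩∁v∣≡1+common v = +-cancelʳ-≡ d _ _ (begin
    ∣ ∁ (set γ) ∩ ∁ (set v) ∣ + d          ≡⟨ cong (∣ ∁ (set γ) ∩ ∁ (set v) ∣ +_) (card γ) ⟨
    ∣ ∁ (set γ) ∩ ∁ (set v) ∣ + ∣ set γ ∣  ≡⟨ ∣∁K∩∁v∣+∣K∣≡∣v∩K∣+1+d (set γ) v ⟩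
    common v + suc d                       ≡⟨ +-suc (common v) d ⟩
    suc (common v) + d                     ∎)
    where open ≡-Reasoning

  adjacent⇒common+common≤d : ∀ {u w} → Adj u w → common u + common w ≤ d
  adjacent⇒common+common≤d {u} {w} u~w =
    subst (common u + common w ≤_) (card γ) (Disjoint⇒∣p∩r∣+∣q∩r∣≤∣r∣ (set u) (set w) (set γ) u~w)

  adjacent⇒d≤1+common+common : ∀ {u w} → Adj u w → d ≤ suc (common u + common w)
  adjacent⇒d≤1+common+common {u} {w} u~w = +-cancelʳ-≤ d d _ (begin
    d + d                                      ≡⟨ cong₂ _+_ (common+∣v∩∁γ∣≡d u) (common+∣v∩∁γ∣≡d w) ⟨
    (common u + rest u) + (common w + rest w)  ≡⟨ interchange (common u) (rest u) (common w) (rest w) ⟩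
    (common u + common w) + (rest u + rest w)  ≤⟨ +-monoʳ-≤ (common u + common w) rest-bound ⟩
    (common u + common w) + suc d              ≡⟨ +-suc (common u + common w) d ⟩
    suc (common u + common w) + d              ∎)
    where
    open ≤-Reasoning
    rest : Vertex d → ℕ
    rest v = ∣ set v ∩ ∁ (set γ) ∣
    rest-bound : rest u + rest w ≤ suc d
    rest-bound = subst (rest u + rest w ≤_) (∣∁v∣≡1+d γ)
                       (Disjoint⇒∣p∩r∣+∣q∩r∣≤∣r∣ (set u) (set w) (∁ (set γ)) u~w)

  record Reachable (k x : ℕ) : Set where
    field
      at-even : ∀ i → k ≡ i + i → d ≤ x + i
      at-odd  : ∀ i → k ≡ suc (i + i) → x ≤ i
  open Reachable

  reachable-step : ∀ {k x y} → Reachable k x → x + y ≤ d → d ≤ suc (x + y) → Reachable (suc k) y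
  reachable-step {k} {x} {y} r x+y≤d d≤1+x+y = record { at-even = at-even′ ; at-odd = at-odd′ }
    where
    at-even′ : ∀ i → suc k ≡ i + i → d ≤ y + i
    at-even′ (suc i) e = begin
      d            ≤⟨ d≤1+x+y ⟩
      suc (x + y)  ≤⟨ s≤s (+-monoˡ-≤ y (at-odd r i (trans (suc-injective e) (+-suc i i)))) ⟩
      suc (i + y)  ≡⟨ cong suc (+-comm i y) ⟩
      suc (y + i)  ≡⟨ +-suc y i ⟨
      y + suc i    ∎
      where open ≤-Reasoning
    at-odd′ : ∀ i → suc k ≡ suc (i + i) → y ≤ i
    at-odd′ i e = +-cancelˡ-≤ x y i (≤-trans x+y≤d (at-even r i (suc-injective e)))

  reachable-γ : Reachable 0 (common γ)
  reachable-γ = record { at-even = at-even′ ; at-odd = λ _ () }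
    where
    at-even′ : ∀ i → 0 ≡ i + i → d ≤ common γ + i
    at-even′ zero _ = ≤-reflexive (sym (trans (+-identityʳ _) (trans (cong ∣_∣ (∩-idem (set γ))) (card γ))))

  reachable : ∀ {P : Vertex d → Set} {u v k} j → Reachable j (common u) → WalkIn P u v k →
              Reachable (j + k) (common v)
  reachable {v = v} j r (nil _) = subst (λ l → Reachable l (common v)) (sym (+-identityʳ j)) r
  reachable {u = u} {v} j r (cons {w = w} {k = k} _ u~w w⇝v) =
    subst (λ l → Reachable l (common v)) (sym (+-suc j k))
      (reachable (suc j) (reachable-step r (adjacent⇒common+common≤d {u} {w} u~w)
                                           (adjacent⇒d≤1+common+common {u} {w} u~w)) w⇝v)

  even-walk⇒d≤common+i : ∀ {P : Vertex d → Set} {v} i → WalkIn P γ v (i + i) → d ≤ common v + i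
  even-walk⇒d≤common+i i γ⇝v = at-even (reachable 0 reachable-γ γ⇝v) i refl

  odd-walk⇒common≤i : ∀ {P : Vertex d → Set} {v} i → WalkIn P γ v (suc (i + i)) → common v ≤ i
  odd-walk⇒common≤i i γ⇝v = at-odd (reachable 0 reachable-γ γ⇝v) i refl

  even-walk : ∀ v i → common v + i ≡ d → WalkIn Anywhere γ v (i + i)
  even-walk v i e = walk-map (λ _ → tt)
    (exchange-walk ⊥ (set γ) γ v i refl (agrees-on-⊥ (set γ) v)
      (+-cancelˡ-≡ (common v) _ _ (trans (common+∣γ∩∁v∣≡d v) (sym e))))

  odd-walk : ∀ v → WalkIn Anywhere γ v (suc (common v + common v))
  odd-walk v =
    let (e , e∈∁γ∩∁v) = ∣p∣≡1+k⇒Nonempty (∁ (set γ) ∩ ∁ (set v)) (∣∁γ∩∁v∣≡1+common v)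
        e∉γ = x∈∁p⇒x∉p (proj₁ (x∈p∩q⁻ (∁ (set γ)) _ e∈∁γ∩∁v))
        z = opposite γ e e∉γ
        ∣z∩∁v∣≡common = suc-injective (trans (x∈∁p∩q⇒1+∣∁[p∪⁅x⁆]∩q∣≡∣∁p∩q∣ e∈∁γ∩∁v) (∣∁γ∩∁v∣≡1+common v))
    in cons {w = z} tt (opposite-adjacent γ e e∉γ) (walk-map (λ _ → tt)
         (exchange-walk ⊥ (set z) z v (common v) refl (agrees-on-⊥ (set z) v) ∣z∩∁v∣≡common))

module EvenSphere {m : ℕ} (γ : Vertex (m + m)) where
  open Distance γ

  sphere⇒common≡m : ∀ v → Sphere (m + m) γ v → common v ≡ m
  sphere⇒common≡m v (γ⇝v , minimal) = ≤-antisym (≮⇒≥ m≮common) m≤common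
    where
    m≤common : m ≤ common v
    m≤common = +-cancelʳ-≤ m m (common v) (even-walk⇒d≤common+i m γ⇝v)
    m≮common : ¬ (m < common v)
    m≮common m<common = minimal (i + i) (+-mono-< i<m i<m) (even-walk v i common+i≡d)
      where
      i = ∣ set γ ∩ ∁ (set v) ∣
      common+i≡d = common+∣γ∩∁v∣≡d v
      i<m : i < m
      i<m = +-cancelˡ-< m i m (subst (m + i <_) common+i≡d (+-monoˡ-< i m<common))

  common≡m⇒sphere : ∀ v → common v ≡ m → Sphere (m + m) γ v
  common≡m⇒sphere v e = even-walk v m (cong (_+ m) e) , no-shorter
    where
    no-shorter : ∀ j → j < m + m → ¬ WalkIn Anywhere γ v j
    no-shorter j j<2m γ⇝v with evenOdd j
    ... | even i = <⇒≱ j<2m (+-mono-≤ m≤i m≤i)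
      where
      m≤i : m ≤ i
      m≤i = +-cancelˡ-≤ m m i (subst (λ c → m + m ≤ c + i) e (even-walk⇒d≤common+i i γ⇝v))
    ... | odd  i = <⇒≱ j<2m (≤-trans (+-mono-≤ m≤i m≤i) (n≤1+n _))
      where
      m≤i : m ≤ i
      m≤i = subst (_≤ i) e (odd-walk⇒common≤i i γ⇝v)

module OddSphere {p : ℕ} (γ : Vertex (suc (p + p))) where
  open Distance γ

  sphere⇒common≡p : ∀ v → Sphere (suc (p + p)) γ v → common v ≡ p
  sphere⇒common≡p v (γ⇝v , minimal) = ≤-antisym (odd-walk⇒common≤i p γ⇝v) (≮⇒≥ common≮p)
    where
    common≮p : ¬ (common v < p)
    common≮p c<p = minimal (suc (common v + common v)) (s≤s (+-mono-< c<p c<p)) (odd-walk v)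

  common≡p⇒sphere : ∀ v → common v ≡ p → Sphere (suc (p + p)) γ v
  common≡p⇒sphere v e = subst (λ c → WalkIn Anywhere γ v (suc (c + c))) e (odd-walk v) , no-shorter
    where
    no-shorter : ∀ j → j < suc (p + p) → ¬ WalkIn Anywhere γ v j
    no-shorter j j<d γ⇝v with evenOdd j
    ... | even i = <⇒≱ (+-mono-< p<i p<i) (s≤s⁻¹ j<d)
      where
      p<i : p < i
      p<i = +-cancelˡ-≤ p (suc p) i
              (subst₂ _≤_ (sym (+-suc p p)) (cong (_+ i) e) (even-walk⇒d≤common+i i γ⇝v))
    ... | odd  i = <⇒≱ j<d (s≤s (+-mono-≤ p≤i p≤i))
      where
      p≤i : p ≤ i
      p≤i = subst (_≤ i) e (odd-walk⇒common≤i i γ⇝v)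

-- Components of a layer

module Layer {d : ℕ} (K : Subset (2 * d + 1)) (p q : ℕ)
             (∣K∣≡2m : ∣ K ∣ ≡ suc p + suc p) (∣∁K∣≡1+2q : ∣ ∁ K ∣ ≡ suc (q + q))
             (m+q≡d : suc p + q ≡ d) where

  m : ℕ
  m = suc p

  InLayer : Vertex d → Set
  InLayer v = ∣ set v ∩ K ∣ ≡ m

  ∣∁u∩K∣≡m : ∀ {u} → InLayer u → ∣ ∁ (set u) ∩ K ∣ ≡ m
  ∣∁u∩K∣≡m {u} u∈L = +-cancelˡ-≡ m _ _
    (trans (cong (_+ ∣ ∁ (set u) ∩ K ∣) (sym u∈L)) (trans (∣p∩q∣+∣∁p∩q∣≡∣q∣ (set u) K) ∣K∣≡2m))

  ∣∁K∩∁u∣≡1+q : ∀ {u} → InLayer u → ∣ ∁ K ∩ ∁ (set u) ∣ ≡ suc q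
  ∣∁K∩∁u∣≡1+q {u} u∈L = +-cancelʳ-≡ (m + m) _ _ (begin
    ∣ ∁ K ∩ ∁ (set u) ∣ + (m + m)  ≡⟨ cong (∣ ∁ K ∩ ∁ (set u) ∣ +_) ∣K∣≡2m ⟨
    ∣ ∁ K ∩ ∁ (set u) ∣ + ∣ K ∣    ≡⟨ ∣∁K∩∁v∣+∣K∣≡∣v∩K∣+1+d K u ⟩
    ∣ set u ∩ K ∣ + suc d          ≡⟨ cong₂ (λ a b → a + suc b) u∈L (sym m+q≡d) ⟩
    m + suc (m + q)                ≡⟨ m+[1+m+q]≡1+q+[m+m] m q ⟩
    suc q + (m + m)                ∎)
    where
    open ≡-Reasoning
    m+[1+m+q]≡1+q+[m+m] : ∀ m q → m + suc (m + q) ≡ suc q + (m + m)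
    m+[1+m+q]≡1+q+[m+m] = solve-∀

  agrees-or-opposes⇒InLayer : ∀ {u w} → InLayer u → AgreesOrOpposes K (set u) w → InLayer w
  agrees-or-opposes⇒InLayer     u∈L (inj₁ w≈u)  = trans (cong ∣_∣ w≈u) u∈L
  agrees-or-opposes⇒InLayer {u} u∈L (inj₂ w≈∁u) = trans (cong ∣_∣ w≈∁u) (∣∁u∩K∣≡m {u} u∈L)

  adjacent⇒opposes : ∀ {u w} → InLayer u → InLayer w → Adj u w → Agrees K (∁ (set u)) w
  adjacent⇒opposes {u} {w} u∈L w∈L u~w =
    p⊆q∧∣q∣≤∣p∣⇒p≡q w∩K⊆∁u∩K (≤-reflexive (trans (∣∁u∩K∣≡m {u} u∈L) (sym w∈L)))
    where
    w∩K⊆∁u∩K : set w ∩ K ⊆ ∁ (set u) ∩ K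
    w∩K⊆∁u∩K i∈w∩K = let (i∈w , i∈K) = x∈p∩q⁻ (set w) K i∈w∩K in
      x∈p∩q⁺ (x∉p⇒x∈∁p (λ i∈u → u~w _ i∈u i∈w) , i∈K)

  walk⇒agrees-or-opposes : ∀ {u v k} → WalkIn InLayer u v k → AgreesOrOpposes K (set u) v
  walk⇒agrees-or-opposes (nil _) = inj₁ refl
  walk⇒agrees-or-opposes {u} (cons {w = w} u∈L u~w w⇝v) with walk⇒agrees-or-opposes w⇝v
  ... | inj₁ v≈w  = inj₂ (trans v≈w (adjacent⇒opposes {u} {w} u∈L (walk-start w⇝v) u~w))
  ... | inj₂ v≈∁w = inj₁ (trans v≈∁w (p∩r≡∁q∩r⇒∁p∩r≡q∩r (set w) (set u) K
                                        (adjacent⇒opposes {u} {w} u∈L (walk-start w⇝v) u~w)))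

  agrees⇒connected : ∀ {u v} → InLayer u → Agrees K (set u) v → ConnIn InLayer u v
  agrees⇒connected {u} {v} u∈L v≈u =
    _ , walk-map (λ {w} → agrees-or-opposes⇒InLayer {u} {w} u∈L)
                 (exchange-walk K (set u) u v _ refl v≈u refl)

  opposes⇒connected : ∀ {u v} → InLayer u → Agrees K (∁ (set u)) v → ConnIn InLayer u v
  opposes⇒connected {u} {v} u∈L v≈∁u =
    let (e , e∈∁K∩∁u) = ∣p∣≡1+k⇒Nonempty (∁ K ∩ ∁ (set u)) (∣∁K∩∁u∣≡1+q {u} u∈L)
        e∉K = x∈∁p⇒x∉p (proj₁ (x∈p∩q⁻ (∁ K) (∁ (set u)) e∈∁K∩∁u))
        e∉u = x∈∁p⇒x∉p (proj₂ (x∈p∩q⁻ (∁ K) (∁ (set u)) e∈∁K∩∁u))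
        z = opposite u e e∉u
        z≈∁u : Agrees K (∁ (set u)) z
        z≈∁u = x∉q⇒∁[p∪⁅x⁆]∩q≡∁p∩q e∉K
        (k , z⇝v) = agrees⇒connected {z} {v} (agrees-or-opposes⇒InLayer {u} {z} u∈L (inj₂ z≈∁u))
                                      (trans v≈∁u (sym z≈∁u))
    in suc k , cons u∈L (opposite-adjacent u e e∉u) z⇝v

  k₀∈K : Nonempty K
  k₀∈K = ∣p∣≡1+k⇒Nonempty K ∣K∣≡2m

  k₀ : Fin (2 * d + 1)
  k₀ = proj₁ k₀∈K

  -- Of two complementary m-subsets of K exactly one avoids k₀.
  K′ : Subset (2 * d + 1)
  K′ = K ∩ ∁ ⁅ k₀ ⁆

  ∣K′∣≡2m-1 : ∣ K′ ∣ ≡ suc (p + p)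
  ∣K′∣≡2m-1 = suc-injective
    (trans (x∈p⇒1+∣p∩∁⁅x⁆∣≡∣p∣ (proj₂ k₀∈K)) (trans ∣K∣≡2m (cong suc (+-suc p p))))

  choose⊆K : ∀ i → choose K′ m i ⊆ K
  choose⊆K i i∈ = p∩q⊆p K (∁ ⁅ k₀ ⁆) (choose-⊆ K′ m i i∈)

  filler : Subset (2 * d + 1)
  filler = choose (∁ K) q (fromℕ< (binomial-positive ∣ ∁ K ∣ q q≤∣∁K∣))
    where
    q≤∣∁K∣ : q ≤ ∣ ∁ K ∣
    q≤∣∁K∣ = subst (q ≤_) (sym ∣∁K∣≡1+2q) (≤-trans (m≤m+n q q) (n≤1+n _))

  filler⊆∁K : filler ⊆ ∁ K
  filler⊆∁K = choose-⊆ (∁ K) q _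

  representative : Fin (binomial ∣ K′ ∣ m) → Vertex d
  representative i = vtx (choose K′ m i ∪ filler) (begin
    ∣ choose K′ m i ∪ filler ∣      ≡⟨ ∣p∪q∣≡∣p∣+∣q∣ _ _ (p⊆r∧q⊆∁r⇒Disjoint (choose⊆K i) filler⊆∁K) ⟩
    ∣ choose K′ m i ∣ + ∣ filler ∣  ≡⟨ cong₂ _+_ (∣choose∣≡k K′ m i) (∣choose∣≡k (∁ K) q _) ⟩
    m + q                           ≡⟨ m+q≡d ⟩
    d                               ∎)
    where open ≡-Reasoning

  representative∩K : ∀ i → set (representative i) ∩ K ≡ choose K′ m i
  representative∩K i = begin
    (choose K′ m i ∪ filler) ∩ K        ≡⟨ ∩-distribʳ-∪ K (choose K′ m i) filler ⟩
    (choose K′ m i ∩ K) ∪ (filler ∩ K)  ≡⟨ cong₂ _∪_ (p⊆q⇒p∩q≡p (choose⊆K i)) filler∩K≡⊥ ⟩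
    choose K′ m i ∪ ⊥                   ≡⟨ ∪-identityʳ (choose K′ m i) ⟩
    choose K′ m i                       ∎
    where
    open ≡-Reasoning
    filler∩K≡⊥ : filler ∩ K ≡ ⊥
    filler∩K≡⊥ = Disjoint⇒p∩q≡⊥ (λ i i∈filler i∈K → x∈p⇒x∉∁p i∈K (filler⊆∁K i∈filler))

  representative∈L : ∀ i → InLayer (representative i)
  representative∈L i = trans (cong ∣_∣ (representative∩K i)) (∣choose∣≡k K′ m i)

  k₀∉representative : ∀ i → k₀ ∉ set (representative i)
  k₀∉representative i k₀∈rep = x∈p⇒x∉∁p (x∈⁅x⁆ k₀) (proj₂ (x∈p∩q⁻ K (∁ ⁅ k₀ ⁆) k₀∈K′))
    where
    k₀∈K′ : k₀ ∈ K′
    k₀∈K′ = choose-⊆ K′ m i (subst (k₀ ∈_) (representative∩K i) (x∈p∩q⁺ (k₀∈rep , proj₂ k₀∈K)))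

  representatives-distinct : ∀ i j → ConnIn InLayer (representative i) (representative j) → i ≡ j
  representatives-distinct i j (_ , i⇝j) with walk⇒agrees-or-opposes i⇝j
  ... | inj₁ j≈i  = choose-injective K′ m i j
    (trans (sym (representative∩K i)) (trans (sym j≈i) (representative∩K j)))
  ... | inj₂ j≈∁i = ⊥-elim (k₀∉representative j (proj₁ (x∈p∩q⁻ _ K k₀∈j∩K)))
    where
    k₀∈j∩K : k₀ ∈ set (representative j) ∩ K
    k₀∈j∩K = subst (k₀ ∈_) (sym j≈∁i) (x∈p∩q⁺ (x∉p⇒x∈∁p (k₀∉representative i) , proj₂ k₀∈K))

  representatives-cover : ∀ v → InLayer v → ∃[ i ] ConnIn InLayer (representative i) v
  representatives-cover v v∈L with k₀ ∈? set v
  ... | no k₀∉v =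
    let (i , i↦v∩K) = choose-surjective K′ m (set v ∩ K) (x∉p⇒p∩q⊆q∩∁⁅x⁆ (set v) K k₀∉v) v∈L in
    i , agrees⇒connected {representative i} {v} (representative∈L i)
          (trans (sym i↦v∩K) (sym (representative∩K i)))
  ... | yes k₀∈v =
    let (i , i↦∁v∩K) = choose-surjective K′ m (∁ (set v) ∩ K)
                         (x∉p⇒p∩q⊆q∩∁⁅x⁆ (∁ (set v)) K (x∈p⇒x∉∁p k₀∈v)) (∣∁u∩K∣≡m {v} v∈L) in
    i , opposes⇒connected {representative i} {v} (representative∈L i)
          (sym (p∩r≡∁q∩r⇒∁p∩r≡q∩r (set (representative i)) (set v) K
                  (trans (representative∩K i) i↦∁v∩K)))

  layer-components : HasComponents InLayer (binomial (suc (p + p)) m)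
  layer-components = subst (λ c → HasComponents InLayer (binomial c m)) ∣K′∣≡2m-1
    (representative , representative∈L , representatives-distinct , representatives-cover)

-- The sphere Γ_d(γ)

even-sphere-components : ∀ p (γ : Vertex (suc p + suc p)) →
                         HasComponents (Sphere (suc p + suc p) γ) (binomial (suc (p + p)) (suc p))
even-sphere-components p γ =
  HasComponents-cong (λ {v} → common≡m⇒sphere v) (λ {v} → sphere⇒common≡m v) layer-components
  where
  open EvenSphere {suc p} γ
  open Layer (set γ) p (suc p) (card γ) (∣∁v∣≡1+d γ) refl

odd-sphere-components : ∀ p (γ : Vertex (suc (p + p))) →
                        HasComponents (Sphere (suc (p + p)) γ) (binomial (suc (p + p)) (suc p))
odd-sphere-components p γ =
  HasComponents-cong (λ {v} → common≡p⇒sphere v ∘ InLayer⇒common≡p v)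
                     (λ {v} → common≡p⇒InLayer v ∘ sphere⇒common≡p v) layer-components
  where
  open Distance γ using (common; common+∣v∩∁γ∣≡d)
  open OddSphere {p} γ
  open Layer (∁ (set γ)) p p (trans (∣∁v∣≡1+d γ) (cong suc (sym (+-suc p p))))
             (trans (cong ∣_∣ (BA.¬-involutive (set γ))) (card γ)) refl
  common+∣v∩∁γ∣≡p+[1+p] : ∀ v → common v + ∣ set v ∩ ∁ (set γ) ∣ ≡ p + suc p
  common+∣v∩∁γ∣≡p+[1+p] v = trans (common+∣v∩∁γ∣≡d v) (sym (+-suc p p))
  common≡p⇒InLayer : ∀ v → common v ≡ p → InLayer v
  common≡p⇒InLayer v e =
    +-cancelˡ-≡ p _ _ (trans (cong (_+ ∣ set v ∩ ∁ (set γ) ∣) (sym e)) (common+∣v∩∁γ∣≡p+[1+p] v))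
  InLayer⇒common≡p : ∀ v → InLayer v → common v ≡ p
  InLayer⇒common≡p v e =
    +-cancelʳ-≡ (suc p) _ _ (trans (cong (common v +_) (sym e)) (common+∣v∩∁γ∣≡p+[1+p] v))

mOf-even : ∀ m → mOf (m + m) ≡ m
mOf-even m with (m + m) % 2 in e
... | zero  = trans (cong (_/ 2) (m+m≡m*2 m)) (m*n/n≡m m 2)
... | suc _ = contradiction (trans (sym e) (trans (cong (_% 2) (m+m≡m*2 m)) (m*n%n≡0 m 2))) λ ()

mOf-odd : ∀ p → mOf (suc (p + p)) ≡ suc p
mOf-odd p with suc (p + p) % 2 in e
... | suc _ = trans (cong (_/ 2) (1+[p+p]+1≡[1+p]*2 p)) (m*n/n≡m (suc p) 2)
  where
  1+[p+p]+1≡[1+p]*2 : ∀ p → suc (p + p) + 1 ≡ suc p * 2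
  1+[p+p]+1≡[1+p]*2 = solve-∀
... | zero  = contradiction
  (trans (sym e) (trans (cong (_% 2) (cong suc (m+m≡m*2 p))) ([m+kn]%n≡m%n 1 p 2))) λ ()

components⇒count∧¬connected : ∀ {d} {S : Vertex d → Set} p → mOf d ≡ suc (suc p) →
                              HasComponents S (binomial (suc (suc p + suc p)) (suc (suc p))) →
                              HasComponents S (((2 * mOf d) C mOf d) / 2) × ¬ ConnectedIn S
components⇒count∧¬connected p mOf≡ components =
  subst (HasComponents _) (sym count≡) components ,
  HasComponents⇒¬ConnectedIn components (2≤binomial[1+2p][1+p] (suc p) (s≤s z≤n))
  where
  count≡ = trans (cong (λ m → ((2 * m) C m) / 2) mOf≡) (half-central-binomial (suc p))

lemma2p2 : (d : ℕ) → 3 ≤ d → (γ : Vertex d) →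
    HasComponents (Sphere d γ) (((2 * mOf d) C mOf d) / 2)
      × ¬ ConnectedIn (Sphere d γ)
lemma2p2 d 3≤d γ with evenOdd d
lemma2p2 _ ()             _ | even zero
lemma2p2 _ (s≤s (s≤s ())) _ | even (suc zero)
lemma2p2 _ _              γ | even (suc (suc p)) =
  components⇒count∧¬connected p (mOf-even (suc (suc p))) (even-sphere-components (suc p) γ)
lemma2p2 _ (s≤s ())       _ | odd zero
lemma2p2 _ _              γ | odd (suc p) =
  components⇒count∧¬connected p (mOf-odd (suc p)) (odd-sphere-components (suc p) γ)
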